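{- Let $p\geq 3$ and $k\geq 1$ be integers and let $G$ be a complete $p$-partite graph of order $n$ with partite sets $X_1,\dots,X_p$ and $\delta(G)\geq k-1$. For a $k$-tuple restrained dominating set $S$ of $G$, let $t(S)$ be the number of indices $i$ with $X_i\not\subseteq S$, and let $t_0=\min\{t(S): S \text{ is a } k\text{ -tuple restrained dominating set of } G \text{ with } S\neq V(G)\}$. If $\gamma_{\times k}^{r}(G)<n$, then \[ \gamma_{\times k}^{r}(G)\leq n-k-\left\lceil \frac{k}{t_0-1}\right\rceil . \]
   Context: All graphs are finite, simple and undirected. For a graph $G=(V,E)$ and $x\in V$, $N[x]$ is the closed neighborhood. For an integer $k\geq 1$ and a graph $G$ with $\delta(G)\geq k-1$: a set $S\subseteq V$ is a $k$-tuple dominating set if $|N[x]\cap S|\geq k$ for every $x\in V$; it is a $k$-tuple restrained dominating set if moreover every vertex of $V-S$ is adjacent to at least $k$ vertices of $V-S$. $\gamma_{\times k}^{r}(G)$ is the minimum cardinality of a $k$-tuple restrained dominating set. (When $\gamma_{\times k}^{r}(G)<n$, every $k$-tuple restrained dominating set $S\neq V(G)$ has $t(S)\geq 2$, so $t_0\geq 2$.) -}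

module Defs where

open import Data.Nat using (ℕ; zero; suc; _+_; _∸_; _≤_; _<_)
open import Data.Nat.DivMod using (_/_)
open import Data.Fin using (Fin; _≟_)
open import Data.Fin.Subset using (Subset; _∈_; _∉_; _⊆_; ∁; _∩_; ∣_∣; ⊤)
open import Data.Fin.Subset.Properties using (_⊆?_)
open import Data.Vec using (tabulate)
open import Data.Bool using (not)
open import Data.Product using (Σ; ∃; _×_)
open import Relation.Nullary using (¬_; does)
open import Relation.Binary.PropositionalEquality using (_≡_; _≢_)

-- A complete p-partite graph on vertex set Fin n is given by a part
-- assignment  part : Fin n → Fin p  whose every part is nonempty
-- (partite sets X_1..X_p are nonempty).  x ~ y  iff  part x ≢ part y.
-- (This is automatically simple and loopless.)

module CompletePartite {n p : ℕ} (part : Fin n → Fin p) where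

  Adj : Fin n → Fin n → Set
  Adj x y = part x ≢ part y

  N : Fin n → Subset n
  N x = tabulate (λ y → not (does (part x ≟ part y)))

  N[_] : Fin n → Subset n
  N[ x ] = tabulate (λ y → not (does (part x ≟ part y)) Data.Bool.∨ does (x ≟ y))

  degree : Fin n → ℕ
  degree x = ∣ N x ∣

  MinDegAtLeast : ℕ → Set
  MinDegAtLeast m = ∀ x → m ≤ degree x

  X : Fin p → Subset n
  X i = tabulate (λ x → does (part x ≟ i))

  IsKTupleRestrainedDom : ℕ → Subset n → Set
  IsKTupleRestrainedDom k S =
    (∀ x → k ≤ ∣ N[ x ] ∩ S ∣) ×
    (∀ x → x ∉ S → k ≤ ∣ N x ∩ ∁ S ∣)

  IsKTupleRestrainedDomNumber : ℕ → ℕ → Set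
  IsKTupleRestrainedDomNumber k g =
    (Σ (Subset n) λ S → IsKTupleRestrainedDom k S × ∣ S ∣ ≡ g) ×
    (∀ S → IsKTupleRestrainedDom k S → g ≤ ∣ S ∣)

  t : Subset n → ℕ
  t S = ∣ tabulate (λ i → not (does (X i ⊆? S))) ∣

  IsT0 : ℕ → ℕ → Set
  IsT0 k m =
    (Σ (Subset n) λ S → IsKTupleRestrainedDom k S × S ≢ ⊤ × t S ≡ m) ×
    (∀ S → IsKTupleRestrainedDom k S → S ≢ ⊤ → m ≤ t S)

-- ceiling division ⌈ a / d ⌉; the value for d = 0 is an irrelevant fallback
-- (in the theorem d = t₀ - 1 ≥ 1 always holds).
⌈_/_⌉ : ℕ → ℕ → ℕ
⌈ a / zero ⌉ = 0
⌈ a / suc d ⌉ = (a + d) / suc d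

-- Let T = V − S for a k-tuple restrained dominating set S ≠ V and put a_i = |T ∩ X_i|.
-- A vertex of T lying in X_i has at least k neighbours in T, all outside X_i, so
-- a_i + k ≤ |T|. Summing over the t(S) parts that meet T gives |T| + t(S)·k ≤ t(S)·|T|,
-- i.e. k ≤ (t(S) − 1)(|T| − k), hence |T| ≥ k + ⌈k / (t(S) − 1)⌉. Taking S with
-- t(S) = t₀ and using γ ≤ |S| = n − |T| gives the bound.

module Submission where

open import Defs
open import Data.Nat using (ℕ; suc; _+_; _*_; _∸_; _≤_; _<_; _≥_; s≤s⁻¹)
open import Data.Nat.Properties hiding (_≟_)
open import Data.Nat.DivMod using (_/_; m<n*o⇒m/o<n)
open import Data.Bool using (false; true; not)
open import Data.Fin using (Fin; zero; suc; _≟_)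
open import Data.Fin.Subset
open import Data.Fin.Subset.Properties
open import Data.Vec using ([]; _∷_; tabulate; here; there)
open import Data.Vec.Properties using (lookup∘tabulate; tabulate-cong; tabulate-∘; []=⇒lookup; lookup⇒[]=)
open import Data.Product using (∃; _×_; _,_)
open import Relation.Nullary using (¬_; Dec; yes; no; does; ¬?; contradiction)
open import Relation.Nullary.Decidable using (decidable-stable; dec-true; dec-false)
open import Relation.Binary.PropositionalEquality
open import Algebra.Properties.CommutativeMonoid.Sum +-0-commutativeMonoid using (sum-syntax; sum-replicate-zero)
open import Algebra.Properties.CommutativeSemigroup +-commutativeSemigroup using (interchange)

∈-tabulate-does⁻ : ∀ {n} {P : Fin n → Set} (P? : ∀ i → Dec (P i)) {i} →
  i ∈ tabulate (λ j → does (P? j)) → P i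
∈-tabulate-does⁻ P? {i} i∈ = decidable-stable (P? i) λ ¬Pi →
  false≢true (trans (sym (dec-false (P? i) ¬Pi)) (trans (sym (lookup∘tabulate _ i)) ([]=⇒lookup i∈)))
  where
  false≢true : false ≢ true
  false≢true ()

∉-tabulate-does⁻ : ∀ {n} {P : Fin n → Set} (P? : ∀ i → Dec (P i)) {i} →
  i ∉ tabulate (λ j → does (P? j)) → ¬ P i
∉-tabulate-does⁻ P? {i} i∉ Pi =
  i∉ (lookup⇒[]= i _ (trans (lookup∘tabulate _ i) (dec-true (P? i) Pi)))

∣p∩q∣+∣p∩∁q∣≡∣p∣ : ∀ {n} (p q : Subset n) → ∣ p ∩ q ∣ + ∣ p ∩ ∁ q ∣ ≡ ∣ p ∣
∣p∩q∣+∣p∩∁q∣≡∣p∣ [] [] = refl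
∣p∩q∣+∣p∩∁q∣≡∣p∣ (outside ∷ p) (_ ∷ q) = ∣p∩q∣+∣p∩∁q∣≡∣p∣ p q
∣p∩q∣+∣p∩∁q∣≡∣p∣ (inside ∷ p) (inside ∷ q) = cong suc (∣p∩q∣+∣p∩∁q∣≡∣p∣ p q)
∣p∩q∣+∣p∩∁q∣≡∣p∣ (inside ∷ p) (outside ∷ q) =
  trans (+-suc ∣ p ∩ q ∣ _) (cong suc (∣p∩q∣+∣p∩∁q∣≡∣p∣ p q))

∣p∣+∣∁p∣≡n : ∀ {n} (p : Subset n) → ∣ p ∣ + ∣ ∁ p ∣ ≡ n
∣p∣+∣∁p∣≡n p = trans (cong (∣ p ∣ +_) (∣∁p∣≡n∸∣p∣ p)) (m+[n∸m]≡n (∣p∣≤n p))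

p⊈q⇒∃∈∉ : ∀ {n} {p q : Subset n} → ¬ p ⊆ q → ∃ λ x → x ∈ p × x ∉ q
p⊈q⇒∃∈∉ {p = p} {q} p⊈q with nonempty? (p ∩ ∁ q)
... | yes (x , x∈p∩∁q) = let (x∈p , x∈∁q) = x∈p∩q⁻ p (∁ q) x∈p∩∁q in x , x∈p , x∈∁p⇒x∉p x∈∁q
... | no p∩∁q-empty = contradiction
  (λ {x} x∈p → x∉∁p⇒x∈p (λ x∈∁q → p∩∁q-empty (x , x∈p∩q⁺ (x∈p , x∈∁q)))) p⊈q

p≢⊤⇒∃∉ : ∀ {n} {p : Subset n} → p ≢ ⊤ → ∃ λ x → x ∉ p
p≢⊤⇒∃∉ p≢⊤ with p⊈q⇒∃∈∉ (λ ⊤⊆p → p≢⊤ (⊆-antisym ⊆⊤ ⊤⊆p))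
... | x , _ , x∉p = x , x∉p

p⊆q⇒∣∁q∩p∣≡0 : ∀ {n} {p q : Subset n} → p ⊆ q → ∣ ∁ q ∩ p ∣ ≡ 0
p⊆q⇒∣∁q∩p∣≡0 {n} {p} {q} p⊆q = trans (cong ∣_∣ (Empty-unique ∁q∩p-empty)) (∣⊥∣≡0 n)
  where
  ∁q∩p-empty : Empty (∁ q ∩ p)
  ∁q∩p-empty (x , x∈∁q∩p) = let (x∈∁q , x∈p) = x∈p∩q⁻ (∁ q) p x∈∁q∩p in x∈∁p⇒x∉p x∈∁q (p⊆q x∈p)

∑+∣p∣*k≤∣p∣*m : ∀ {n} k m (p : Subset n) (a : Fin n → ℕ) →
  (∀ {i} → i ∈ p → a i + k ≤ m) → (∀ {i} → i ∉ p → a i ≡ 0) →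
  ∑[ i < n ] a i + ∣ p ∣ * k ≤ ∣ p ∣ * m
∑+∣p∣*k≤∣p∣*m k m [] a _ _ = ≤-refl
∑+∣p∣*k≤∣p∣*m k m (s ∷ p) a bound-in zero-out
  with ∑+∣p∣*k≤∣p∣*m k m p (λ i → a (suc i)) (λ i∈p → bound-in (there i∈p))
                          (λ i∉p → zero-out λ i∈ → i∉p (drop-there i∈))
... | ih with s
... | outside = subst (λ a₀ → a₀ + ∑[ i < _ ] a (suc i) + ∣ p ∣ * k ≤ ∣ p ∣ * m) (sym (zero-out λ ())) ih
... | inside  = begin
  a zero + ∑[ i < _ ] a (suc i) + (k + ∣ p ∣ * k)   ≡⟨ interchange (a zero) _ k _ ⟩
  (a zero + k) + (∑[ i < _ ] a (suc i) + ∣ p ∣ * k) ≤⟨ +-mono-≤ (bound-in here) ih ⟩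
  m + ∣ p ∣ * m                                     ∎
  where open ≤-Reasoning

m≤[1+n]*o⇒⌈m/[1+n]⌉≤o : ∀ m n o → m ≤ suc n * o → ⌈ m / suc n ⌉ ≤ o
m≤[1+n]*o⇒⌈m/[1+n]⌉≤o m n o m≤[1+n]*o = s≤s⁻¹ (m<n*o⇒m/o<n (begin-strict
  m + n               ≤⟨ +-monoˡ-≤ n m≤[1+n]*o ⟩
  suc n * o + n       ≡⟨ +-comm (suc n * o) n ⟩
  n + suc n * o       <⟨ n<1+n _ ⟩
  suc n + suc n * o   ≡⟨ *-suc (suc n) o ⟨
  suc n * suc o       ≡⟨ *-comm (suc n) (suc o) ⟩
  suc o * suc n       ∎))
  where open ≤-Reasoning

k+⌈k/[c∸1]⌉≤m : ∀ {k m} c → 1 ≤ k → k ≤ m → m + c * k ≤ c * m → k + ⌈ k / (c ∸ 1) ⌉ ≤ m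
k+⌈k/[c∸1]⌉≤m {k} {m} 0 1≤k k≤m m+0≤0 =
  contradiction (subst (_≤ 0) (+-identityʳ m) m+0≤0) (<⇒≱ (≤-trans 1≤k k≤m))
k+⌈k/[c∸1]⌉≤m {k} {m} 1 1≤k k≤m m+k≤m
  rewrite *-identityˡ k | *-identityˡ m = contradiction m+k≤m (<⇒≱ (m<m+n m 1≤k))
k+⌈k/[c∸1]⌉≤m {k} (suc (suc d)) 1≤k k≤m h with m≤n⇒∃[o]m+o≡n k≤m
... | r , refl = +-monoʳ-≤ k (m≤[1+n]*o⇒⌈m/[1+n]⌉≤o k d r k≤[1+d]*r)
  where
  k+r≤r+[1+d]*r : k + r ≤ r + suc d * r
  k+r≤r+[1+d]*r = +-cancelˡ-≤ (suc (suc d) * k) _ _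
    (subst₂ _≤_ (+-comm (k + r) _) (*-distribˡ-+ (suc (suc d)) k r) h)
  k≤[1+d]*r : k ≤ suc d * r
  k≤[1+d]*r = +-cancelʳ-≤ r k _ (subst (k + r ≤_) (+-comm r _) k+r≤r+[1+d]*r)

∑∣[j≟i]∷r∣≡1+∑∣r∣ : ∀ {p n} (j : Fin p) (r : Fin p → Subset n) →
  ∑[ i < p ] ∣ does (j ≟ i) ∷ r i ∣ ≡ suc (∑[ i < p ] ∣ r i ∣)
∑∣[j≟i]∷r∣≡1+∑∣r∣ zero r = refl
∑∣[j≟i]∷r∣≡1+∑∣r∣ (suc j) r =
  trans (cong (∣ r zero ∣ +_) (∑∣[j≟i]∷r∣≡1+∑∣r∣ j (λ i → r (suc i)))) (+-suc ∣ r zero ∣ _)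

∑∣q∩X∣≡∣q∣ : ∀ {n p} (part : Fin n → Fin p) (q : Subset n) →
  ∑[ i < p ] ∣ q ∩ CompletePartite.X part i ∣ ≡ ∣ q ∣
∑∣q∩X∣≡∣q∣ {p = p} part [] = sum-replicate-zero p
∑∣q∩X∣≡∣q∣ part (outside ∷ q) = ∑∣q∩X∣≡∣q∣ (λ x → part (suc x)) q
∑∣q∩X∣≡∣q∣ part (inside ∷ q) =
  trans (∑∣[j≟i]∷r∣≡1+∑∣r∣ (part zero) (λ i → q ∩ CompletePartite.X (λ x → part (suc x)) i))
        (cong suc (∑∣q∩X∣≡∣q∣ (λ x → part (suc x)) q))

does-≟-sym : ∀ {n} (i j : Fin n) → does (i ≟ j) ≡ does (j ≟ i)
does-≟-sym i j with i ≟ j | j ≟ i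
... | yes _   | yes _   = refl
... | no _    | no _    = refl
... | yes i≡j | no j≢i  = contradiction (sym i≡j) j≢i
... | no i≢j  | yes j≡i = contradiction (sym j≡i) i≢j

module _ {n p : ℕ} (part : Fin n → Fin p) where
  open CompletePartite part

  N≡∁X : ∀ x → N x ≡ ∁ (X (part x))
  N≡∁X x = trans (tabulate-cong λ y → cong not (does-≟-sym (part x) (part y)))
                 (tabulate-∘ not λ y → does (part y ≟ part x))

  module _ {k : ℕ} {S : Subset n} (restrained : ∀ x → x ∉ S → k ≤ ∣ N x ∩ ∁ S ∣) where

    ∣∁S∩X∣+k≤∣∁S∣ : ∀ {x} → x ∉ S → ∣ ∁ S ∩ X (part x) ∣ + k ≤ ∣ ∁ S ∣
    ∣∁S∩X∣+k≤∣∁S∣ {x} x∉S = begin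
      ∣ ∁ S ∩ X (part x) ∣ + k                      ≤⟨ +-monoʳ-≤ _ (restrained x x∉S) ⟩
      ∣ ∁ S ∩ X (part x) ∣ + ∣ N x ∩ ∁ S ∣          ≡⟨ cong (λ q → ∣ ∁ S ∩ X (part x) ∣ + ∣ q ∣) N∩∁S≡∁S∩∁X ⟩
      ∣ ∁ S ∩ X (part x) ∣ + ∣ ∁ S ∩ ∁ (X (part x)) ∣ ≡⟨ ∣p∩q∣+∣p∩∁q∣≡∣p∣ (∁ S) (X (part x)) ⟩
      ∣ ∁ S ∣                                       ∎
      where
      open ≤-Reasoning
      N∩∁S≡∁S∩∁X : N x ∩ ∁ S ≡ ∁ S ∩ ∁ (X (part x))
      N∩∁S≡∁S∩∁X = trans (cong (_∩ ∁ S) (N≡∁X x)) (∩-comm _ _)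

    ∣∁S∣+t*k≤t*∣∁S∣ : ∣ ∁ S ∣ + t S * k ≤ t S * ∣ ∁ S ∣
    ∣∁S∣+t*k≤t*∣∁S∣ = subst (λ m → m + t S * k ≤ t S * ∣ ∁ S ∣) (∑∣q∩X∣≡∣q∣ part (∁ S))
      (∑+∣p∣*k≤∣p∣*m k ∣ ∁ S ∣ _ (λ i → ∣ ∁ S ∩ X i ∣) X⊈S⇒bound X⊆S⇒empty)
      where
      X⊈S⇒bound : ∀ {i} → i ∈ tabulate (λ j → not (does (X j ⊆? S))) → ∣ ∁ S ∩ X i ∣ + k ≤ ∣ ∁ S ∣
      X⊈S⇒bound i∈ with p⊈q⇒∃∈∉ (∈-tabulate-does⁻ (λ j → ¬? (X j ⊆? S)) i∈)
      ... | x , x∈Xi , x∉S =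
        subst (λ j → ∣ ∁ S ∩ X j ∣ + k ≤ ∣ ∁ S ∣) (∈-tabulate-does⁻ (λ y → part y ≟ _) x∈Xi) (∣∁S∩X∣+k≤∣∁S∣ x∉S)
      X⊆S⇒empty : ∀ {i} → i ∉ tabulate (λ j → not (does (X j ⊆? S))) → ∣ ∁ S ∩ X i ∣ ≡ 0
      X⊆S⇒empty {i} i∉ = p⊆q⇒∣∁q∩p∣≡0
        (decidable-stable (X i ⊆? S) (∉-tabulate-does⁻ (λ j → ¬? (X j ⊆? S)) i∉))

    ∣S∣+k+⌈k/[t∸1]⌉≤n : 1 ≤ k → S ≢ ⊤ → ∣ S ∣ + k + ⌈ k / (t S ∸ 1) ⌉ ≤ n
    ∣S∣+k+⌈k/[t∸1]⌉≤n 1≤k S≢⊤ = begin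
      ∣ S ∣ + k + ⌈ k / (t S ∸ 1) ⌉   ≡⟨ +-assoc ∣ S ∣ k _ ⟩
      ∣ S ∣ + (k + ⌈ k / (t S ∸ 1) ⌉) ≤⟨ +-monoʳ-≤ ∣ S ∣ ∣∁S∣-bound ⟩
      ∣ S ∣ + ∣ ∁ S ∣                 ≡⟨ ∣p∣+∣∁p∣≡n S ⟩
      n                               ∎
      where
      open ≤-Reasoning
      k≤∣∁S∣ : k ≤ ∣ ∁ S ∣
      k≤∣∁S∣ with p≢⊤⇒∃∉ S≢⊤
      ... | x , x∉S = ≤-trans (m≤n+m k _) (∣∁S∩X∣+k≤∣∁S∣ x∉S)
      ∣∁S∣-bound : k + ⌈ k / (t S ∸ 1) ⌉ ≤ ∣ ∁ S ∣
      ∣∁S∣-bound = k+⌈k/[c∸1]⌉≤m (t S) 1≤k k≤∣∁S∣ ∣∁S∣+t*k≤t*∣∁S∣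

proposition2p10 : (p k n : ℕ) → p ≥ 3 → k ≥ 1 →
    (part : Fin n → Fin p) → (∀ i → ∃ λ x → part x ≡ i) →
    CompletePartite.MinDegAtLeast part (k ∸ 1) →
    (g t₀ : ℕ) →
    CompletePartite.IsKTupleRestrainedDomNumber part k g →
    CompletePartite.IsT0 part k t₀ →
    g < n →
    g + k + ⌈ k / (t₀ ∸ 1) ⌉ ≤ n
proposition2p10 p k n _ k≥1 part _ _ g t₀ (_ , g-minimal) ((S , S-dom@(_ , S-restrained) , S≢⊤ , tS≡t₀) , _) _ = begin
  g + k + ⌈ k / (t₀ ∸ 1) ⌉      ≤⟨ +-monoˡ-≤ _ (+-monoˡ-≤ k (g-minimal S S-dom)) ⟩
  ∣ S ∣ + k + ⌈ k / (t₀ ∸ 1) ⌉  ≡⟨ cong (λ c → ∣ S ∣ + k + ⌈ k / (c ∸ 1) ⌉) tS≡t₀ ⟨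
  ∣ S ∣ + k + ⌈ k / (t S ∸ 1) ⌉ ≤⟨ ∣S∣+k+⌈k/[t∸1]⌉≤n part S-restrained k≥1 S≢⊤ ⟩
  n                             ∎
  where
  open ≤-Reasoning
  open CompletePartite part using (t)
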